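{- Let $k$ and $i$ be non-negative integers with $i\ge k$. Then $$f(2^k-1,i) = 1+(i-k)k.$$
   Context: For an integer $n$ and an integer $i\ge 0$, $f(n,i)$ denotes the number of binary signed-digit (BSD) representations of $n$ on $i$ bits, i.e. the number of tuples $(b_{i-1},\dots,b_0)\in\{1,0,-1\}^i$ with $n=\sum_{j=0}^{i-1} b_j 2^j$. -}

module Defs where

open import Data.Nat using (ℕ; zero; suc)
open import Data.Integer using (ℤ; +_; -[1+_]; _+_; _*_)
open import Data.List using (List; []; _∷_; map; concatMap; length; filter)
open import Data.Vec using (Vec; []; _∷_)
open import Data.Integer.Properties using (_≟_)

data Digit : Set where
  one zer neg : Digit

digitVal : Digit → ℤ
digitVal one = + 1
digitVal zer = + 0
digitVal neg = -[1+ 0 ]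

allDigits : List Digit
allDigits = one ∷ zer ∷ neg ∷ []

-- All tuples in {1,0,-1}^i, written b_0 ∷ b_1 ∷ … ∷ b_{i-1} (least significant first).
allTuples : (i : ℕ) → List (Vec Digit i)
allTuples zero = [] ∷ []
allTuples (suc i) = concatMap (λ d → map (d ∷_) (allTuples i)) allDigits

value : ∀ {i} → Vec Digit i → ℤ
value [] = + 0
value (b ∷ bs) = digitVal b + + 2 * value bs

f : ℤ → ℕ → ℕ
f n i = length (filter (λ v → value v ≟ n) (allTuples i))

{-# OPTIONS --safe #-}
-- Splitting off the least significant digit b₀ gives the recurrences
--   f(2m, i+1) = f(m, i)   and   f(2m-1, i+1) = f(m-1, i) + f(m, i),
-- since b₀ must be 0 for an even number and ±1 for an odd one.  The first
-- yields f(2ᵏ, i) = i - k from f(1, i) = i, and the second, applied to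
-- m = 2ᵏ, turns f(2ᵏ⁺¹-1, i+1) into f(2ᵏ-1, i) + (i - k), so the claim
-- follows by induction on k.
module Submission where

open import Defs
open import Algebra.Bundles using (AbelianGroup)
import Algebra.Properties.Group as GroupProperties
open import Data.Bool using (true; false)
open import Data.Integer using (+_; -[1+_])
import Data.Integer as ℤ
import Data.Integer.Properties as ℤ
open import Data.Integer.Tactic.RingSolver using (solve-∀)
open import Data.List using (List; []; _∷_; _++_; map; concatMap; length; filter)
open import Data.List.Properties using (length-++; filter-++; filter-≐; filter-none; map-cong)
import Data.List.Relation.Unary.All as All
open import Data.Nat using (ℕ; zero; suc; s≤s; _≤_; _+_; _*_; _∸_; _^_)
open import Data.Nat.ListAction using (sum)
open import Data.Nat.Properties using (+-identityʳ; +-comm; *-zeroʳ; *-suc; even≢odd)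
open import Data.Product using (_,_)
open import Data.Vec using (Vec; _∷_)
open import Function using (_∘_)
open import Level using (Level)
open import Relation.Binary.PropositionalEquality
  using (_≡_; _≢_; refl; sym; trans; cong; cong₂; module ≡-Reasoning)
open import Relation.Nullary using (does)
open import Relation.Unary using (Pred; Decidable)

open ≡-Reasoning

module _ {a b p : Level} {A : Set a} {B : Set b} {P : Pred A p} (P? : Decidable P) where

  length-filter-++ : ∀ xs ys →
    length (filter P? (xs ++ ys)) ≡ length (filter P? xs) + length (filter P? ys)
  length-filter-++ xs ys = trans (cong length (filter-++ P? xs ys)) (length-++ (filter P? xs))

  length-filter-concatMap : ∀ (g : B → List A) xs →
    length (filter P? (concatMap g xs)) ≡ sum (map (length ∘ filter P? ∘ g) xs)
  length-filter-concatMap g [] = refl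
  length-filter-concatMap g (x ∷ xs) =
    trans (length-filter-++ (g x) (concatMap g xs))
          (cong (_+_ (length (filter P? (g x)))) (length-filter-concatMap g xs))

  length-filter-map : ∀ (g : B → A) xs →
    length (filter P? (map g xs)) ≡ length (filter (P? ∘ g) xs)
  length-filter-map g [] = refl
  length-filter-map g (x ∷ xs) with does (P? (g x))
  ... | true  = cong suc (length-filter-map g xs)
  ... | false = length-filter-map g xs

+2*-injective : ∀ c {x y} → c ℤ.+ + 2 ℤ.* x ≡ c ℤ.+ + 2 ℤ.* y → x ≡ y
+2*-injective c {x} {y} eq =
  ℤ.*-cancelˡ-≡ (+ 2) x y (∙-cancelˡ c (+ 2 ℤ.* x) (+ 2 ℤ.* y) eq)
  where open GroupProperties (AbelianGroup.group ℤ.+-0-abelianGroup) using (∙-cancelˡ)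

odd≢even : ∀ a b → + 1 ℤ.+ + 2 ℤ.* a ≢ + 2 ℤ.* b
odd≢even a b eq = even≢odd ℤ.∣ b ℤ.- a ∣ 0 (sym (begin
  1                            ≡⟨ cong ℤ.∣_∣ (trans (difference a) (cong (ℤ._- + 2 ℤ.* a) eq)) ⟩
  ℤ.∣ + 2 ℤ.* b ℤ.- + 2 ℤ.* a ∣ ≡⟨ cong ℤ.∣_∣ (factor a b) ⟩
  ℤ.∣ + 2 ℤ.* (b ℤ.- a) ∣       ≡⟨ ℤ.abs-* (+ 2) (b ℤ.- a) ⟩
  2 * ℤ.∣ b ℤ.- a ∣             ∎))
  where
  difference : ∀ a → + 1 ≡ (+ 1 ℤ.+ + 2 ℤ.* a) ℤ.- + 2 ℤ.* a
  difference = solve-∀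
  factor : ∀ a b → + 2 ℤ.* b ℤ.- + 2 ℤ.* a ≡ + 2 ℤ.* (b ℤ.- a)
  factor = solve-∀

fWithLowDigit : Digit → ℤ.ℤ → ℕ → ℕ
fWithLowDigit d n i = length (filter (λ v → value (d ∷ v) ℤ.≟ n) (allTuples i))

f-suc : ∀ n i → f n (suc i) ≡ sum (map (λ d → fWithLowDigit d n i) allDigits)
f-suc n i =
  trans (length-filter-concatMap P? (λ d → map (d ∷_) (allTuples i)) allDigits)
        (cong sum (map-cong (λ d → length-filter-map P? (d ∷_) (allTuples i)) allDigits))
  where P? = λ (v : Vec Digit (suc i)) → value v ℤ.≟ n

fWithLowDigit-hit : ∀ d {n m} i → digitVal d ℤ.+ + 2 ℤ.* m ≡ n → fWithLowDigit d n i ≡ f m i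
fWithLowDigit-hit d {n} {m} i hit = cong length
  (filter-≐ (λ v → value (d ∷ v) ℤ.≟ n) (λ v → value v ℤ.≟ m)
            ((λ eq → +2*-injective (digitVal d) (trans eq (sym hit)))
            , (λ eq → trans (cong (λ x → digitVal d ℤ.+ + 2 ℤ.* x) eq) hit))
            (allTuples i))

fWithLowDigit-miss : ∀ d {n} i → (∀ x → digitVal d ℤ.+ + 2 ℤ.* x ≢ n) → fWithLowDigit d n i ≡ 0
fWithLowDigit-miss d {n} i miss = cong length
  (filter-none (λ v → value (d ∷ v) ℤ.≟ n) (All.universal (miss ∘ value) (allTuples i)))

f-even : ∀ m i → f (+ 2 ℤ.* m) (suc i) ≡ f m i
f-even m i = begin
  f (+ 2 ℤ.* m) (suc i)
    ≡⟨ f-suc _ i ⟩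
  fWithLowDigit one _ i + (fWithLowDigit zer _ i + (fWithLowDigit neg _ i + 0))
    ≡⟨ cong₂ _+_ (fWithLowDigit-miss one i (λ x → odd≢even x m))
                 (cong₂ _+_ (fWithLowDigit-hit zer i (ℤ.+-identityˡ _))
                            (cong (_+ 0) (fWithLowDigit-miss neg i (λ x → odd≢even (x ℤ.- + 1) m ∘ trans (oddViaNeg x))))) ⟩
  f m i + 0
    ≡⟨ +-identityʳ (f m i) ⟩
  f m i ∎
  where
  oddViaNeg : ∀ x → + 1 ℤ.+ + 2 ℤ.* (x ℤ.- + 1) ≡ -[1+ 0 ] ℤ.+ + 2 ℤ.* x
  oddViaNeg = solve-∀

f-odd : ∀ m i → f (+ 2 ℤ.* m ℤ.- + 1) (suc i) ≡ f (m ℤ.- + 1) i + f m i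
f-odd m i = begin
  f (+ 2 ℤ.* m ℤ.- + 1) (suc i)
    ≡⟨ f-suc _ i ⟩
  fWithLowDigit one _ i + (fWithLowDigit zer _ i + (fWithLowDigit neg _ i + 0))
    ≡⟨ cong₂ _+_ (fWithLowDigit-hit one i (viaOne m))
                 (cong₂ _+_ (fWithLowDigit-miss zer i (λ x eq → odd≢even (m ℤ.- + 1) x
                                                    (trans (viaOne m) (trans (sym eq) (ℤ.+-identityˡ _)))))
                            (cong (_+ 0) (fWithLowDigit-hit neg i (viaNeg m)))) ⟩
  f (m ℤ.- + 1) i + (f m i + 0)
    ≡⟨ cong (_+_ (f (m ℤ.- + 1) i)) (+-identityʳ (f m i)) ⟩
  f (m ℤ.- + 1) i + f m i ∎
  where
  viaOne : ∀ m → + 1 ℤ.+ + 2 ℤ.* (m ℤ.- + 1) ≡ + 2 ℤ.* m ℤ.- + 1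
  viaOne = solve-∀
  viaNeg : ∀ m → -[1+ 0 ] ℤ.+ + 2 ℤ.* m ≡ + 2 ℤ.* m ℤ.- + 1
  viaNeg = solve-∀

f-zero : ∀ i → f (+ 0) i ≡ 1
f-zero zero    = refl
f-zero (suc i) = trans (f-even (+ 0) i) (f-zero i)

f-one : ∀ i → f (+ 1) i ≡ i
f-one zero    = refl
f-one (suc i) = trans (f-odd (+ 1) i) (cong₂ _+_ (f-zero i) (f-one i))

f-2^ : ∀ k i → k ≤ i → f (+ (2 ^ k)) i ≡ i ∸ k
f-2^ zero    i       _         = f-one i
f-2^ (suc k) (suc i) (s≤s k≤i) = begin
  f (+ (2 ^ suc k)) (suc i)     ≡⟨ cong (λ n → f n (suc i)) (ℤ.pos-* 2 (2 ^ k)) ⟩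
  f (+ 2 ℤ.* + (2 ^ k)) (suc i) ≡⟨ f-even (+ (2 ^ k)) i ⟩
  f (+ (2 ^ k)) i               ≡⟨ f-2^ k i k≤i ⟩
  i ∸ k                         ∎

lemma2 : (k i : ℕ) → k ≤ i → f ((+ (2 ^ k)) ℤ.- (+ 1)) i ≡ 1 + (i ∸ k) * k
lemma2 zero    i       _         = trans (f-zero i) (cong suc (sym (*-zeroʳ i)))
lemma2 (suc k) (suc i) (s≤s k≤i) = begin
  f (+ (2 ^ suc k) ℤ.- + 1) (suc i)         ≡⟨ cong (λ n → f (n ℤ.- + 1) (suc i)) (ℤ.pos-* 2 (2 ^ k)) ⟩
  f (+ 2 ℤ.* + (2 ^ k) ℤ.- + 1) (suc i)     ≡⟨ f-odd (+ (2 ^ k)) i ⟩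
  f (+ (2 ^ k) ℤ.- + 1) i + f (+ (2 ^ k)) i ≡⟨ cong₂ _+_ (lemma2 k i k≤i) (f-2^ k i k≤i) ⟩
  1 + (i ∸ k) * k + (i ∸ k)                 ≡⟨ cong suc (+-comm ((i ∸ k) * k) (i ∸ k)) ⟩
  1 + ((i ∸ k) + (i ∸ k) * k)               ≡⟨ cong suc (sym (*-suc (i ∸ k) k)) ⟩
  1 + (i ∸ k) * suc k                       ∎
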